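{- Let $n,k,j$ be integers with $0<k<n$, $0<j<n$, $k\ne j$. If $k-j$ divides $k$, then $x^n-x^k+1$ and $x^n-x^j+1$ dyadically resolve.
   Context: Two polynomials with integer coefficients \emph{dyadically resolve} if their resultant (over $\mathbb{Q}$) equals $\pm 2^m$ for some nonnegative integer $m$. -}

module Defs where

open import Data.Nat as ℕ using (ℕ; zero; suc; _∸_; _<ᵇ_; _≡ᵇ_)
open import Data.Integer as ℤ using (ℤ; +_; -_; _+_; _*_)
open import Data.Fin using (Fin; toℕ; punchIn)
  renaming (zero to fzero; suc to fsuc)
open import Data.Bool using (Bool; true; false; if_then_else_)
open import Data.Product using (∃)
open import Data.Sum using (_⊎_)
open import Relation.Binary.PropositionalEquality using (_≡_)

-- A polynomial with integer coefficients of (formal) degree d is given by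
-- d together with its coefficient function  coeff : ℕ → ℤ,
-- coeff i = coefficient of x^i (only coeff 0 .. coeff d are used).

sumFin : (n : ℕ) → (Fin n → ℤ) → ℤ
sumFin zero    f = + 0
sumFin (suc n) f = f fzero + sumFin n (λ i → f (fsuc i))

sgn : ℕ → ℤ
sgn zero = + 1
sgn (suc i) = - sgn i

det : (n : ℕ) → (Fin n → Fin n → ℤ) → ℤ
det zero    M = + 1
det (suc n) M =
  sumFin (suc n) (λ j → sgn (toℕ j) * (M fzero j * det n (λ r c → M (fsuc r) (punchIn j c))))

-- Entry in row r (0-based, within the block for p) and column c of the
-- Sylvester block of a polynomial p of degree d: the coefficient vector
-- (p_d, p_{d-1}, ..., p_0) shifted right by r places.
sylEntry : (d : ℕ) → (ℕ → ℤ) → ℕ → ℕ → ℤ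
sylEntry d p r c =
  if c <ᵇ r then + 0
  else (if d <ᵇ (c ∸ r) then + 0 else p (d ∸ (c ∸ r)))

sylvester : (d e : ℕ) → (ℕ → ℤ) → (ℕ → ℤ) → Fin (d ℕ.+ e) → Fin (d ℕ.+ e) → ℤ
sylvester d e f g r c =
  if toℕ r <ᵇ e then sylEntry d f (toℕ r) (toℕ c)
  else sylEntry e g (toℕ r ∸ e) (toℕ c)

resultant : (d e : ℕ) → (ℕ → ℤ) → (ℕ → ℤ) → ℤ
resultant d e f g = det (d ℕ.+ e) (sylvester d e f g)

DyadicallyResolve : (d e : ℕ) → (ℕ → ℤ) → (ℕ → ℤ) → Set
DyadicallyResolve d e f g =
  ∃ λ m → (resultant d e f g ≡ + (2 ℕ.^ m)) ⊎ (resultant d e f g ≡ - (+ (2 ℕ.^ m)))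

δ : ℕ → ℕ → ℤ
δ a i = if i ≡ᵇ a then + 1 else + 0

trinomial : ℕ → ℕ → (ℕ → ℤ)
trinomial n k i = δ n i ℤ.- δ k i + δ 0 i

-- The resultant is computed on the Sylvester matrix by row operations, which preserve the
-- determinant, and by expansions along columns with a single unit entry, which preserve it up
-- to sign. Subtracting the rows of f = x^n - x^k + 1 from those of x^n - x^j + 1 replaces the
-- second trinomial by x^k - x^j = ε x^s (x^d - 1), where s = min k j, d = |k - j| and ε = ±1.
-- As f is monic with constant term 1, the factor x^s and the surplus rows can be expanded
-- away, leaving Res(f, ε (x^d - 1)). Since d divides k, f ≡ x^n modulo x^d - 1, and
-- Res(x^m, ε (x^d - 1)) = ±1 follows by reducing x^m to x^(m - d).
module Submission where

open import Defs
open import Data.Nat as ℕ using (ℕ; zero; suc; z≤n; s≤s; _<_; _∸_)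
import Data.Nat.Properties as ℕP
import Data.Nat.Tactic.RingSolver as ℕSolver
open import Data.Nat.Induction using (<-rec)
open import Data.Integer as ℤ using (ℤ; +_; -_; _+_; _-_; _*_)
import Data.Integer.Properties as ℤP
open import Data.Integer.Divisibility using (_∣_)
open import Data.Nat.Divisibility using (divides)
open import Data.Integer.Tactic.RingSolver using (solve-∀)
open import Data.Fin as F using (Fin; toℕ; punchIn; punchOut)
  renaming (zero to fzero; suc to fsuc)
import Data.Fin.Properties as FP
open import Data.Bool using (T; true; false; if_then_else_)
open import Data.Bool.Properties using (T-≡)
open import Function.Bundles using (Equivalence)
open import Data.Product using (∃; _×_; _,_; proj₁; proj₂)
open import Data.Sum using (_⊎_; inj₁; inj₂)
open import Data.Empty using (⊥-elim)
open import Relation.Binary.Definitions using (tri<; tri≈; tri>)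
open import Relation.Nullary using (Dec; yes; no; ¬_)
open import Relation.Binary.PropositionalEquality
  using (_≡_; _≢_; refl; sym; trans; cong; cong₂; subst; module ≡-Reasoning)
import Relation.Binary.Reasoning.Base.Single as SingleReasoning

infix 4 _≈±_
_≈±_ : ℤ → ℤ → Set
a ≈± b = a ≡ b ⊎ a ≡ - b

IsUnit : ℤ → Set
IsUnit u = u ≈± + 1

≈±-refl : ∀ {a} → a ≈± a
≈±-refl = inj₁ refl

≈±-trans : ∀ {a b c} → a ≈± b → b ≈± c → a ≈± c
≈±-trans (inj₁ refl) q = q
≈±-trans (inj₂ refl) (inj₁ refl) = inj₂ refl
≈±-trans (inj₂ refl) (inj₂ refl) = inj₁ (ℤP.neg-involutive _)

module ≈±-Reasoning = SingleReasoning _≈±_ ≈±-refl ≈±-trans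

isUnit-neg : ∀ {u} → IsUnit u → IsUnit (- u)
isUnit-neg (inj₁ refl) = inj₂ refl
isUnit-neg (inj₂ refl) = inj₁ refl

isUnit-* : ∀ {u v} → IsUnit u → IsUnit v → IsUnit (u * v)
isUnit-* (inj₁ refl) v = subst IsUnit (sym (ℤP.*-identityˡ _)) v
isUnit-* (inj₂ refl) v = subst IsUnit (sym (ℤP.-1*i≡-i _)) (isUnit-neg v)

isUnit-sgn : ∀ k → IsUnit (sgn k)
isUnit-sgn zero = inj₁ refl
isUnit-sgn (suc k) = isUnit-neg (isUnit-sgn k)

unit-*-≈± : ∀ {u} → IsUnit u → ∀ d → u * d ≈± d
unit-*-≈± (inj₁ refl) d = inj₁ (ℤP.*-identityˡ d)
unit-*-≈± (inj₂ refl) d = inj₂ (ℤP.-1*i≡-i d)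

x≡-x⇒x≡0 : ∀ x → x ≡ - x → x ≡ + 0
x≡-x⇒x≡0 (+ zero) _ = refl

sgn-involutive : ∀ k x → sgn k * (sgn k * x) ≡ x
sgn-involutive zero x = trans (ℤP.*-identityˡ _) (ℤP.*-identityˡ x)
sgn-involutive (suc k) x = trans (neg-neg (sgn k) x) (sgn-involutive k x)
  where
  neg-neg : ∀ s x → (- s) * ((- s) * x) ≡ s * (s * x)
  neg-neg = solve-∀

sgn-*-cancel : ∀ k x → sgn k * x ≡ + 0 → x ≡ + 0
sgn-*-cancel k x e = trans (sym (sgn-involutive k x)) (trans (cong (sgn k *_) e) (ℤP.*-zeroʳ (sgn k)))

-- Finite sums

sumFin-cong : ∀ n {f g : Fin n → ℤ} → (∀ i → f i ≡ g i) → sumFin n f ≡ sumFin n g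
sumFin-cong zero h = refl
sumFin-cong (suc n) h = cong₂ _+_ (h fzero) (sumFin-cong n (λ i → h (fsuc i)))

sumFin-+ : ∀ n (f g : Fin n → ℤ) → sumFin n (λ i → f i + g i) ≡ sumFin n f + sumFin n g
sumFin-+ zero f g = refl
sumFin-+ (suc n) f g =
  trans (cong (_+_ (f fzero + g fzero)) (sumFin-+ n _ _)) (interchange (f fzero) (g fzero) _ _)
  where
  interchange : ∀ a b c d → (a + b) + (c + d) ≡ (a + c) + (b + d)
  interchange = solve-∀

sumFin-* : ∀ n z (f : Fin n → ℤ) → sumFin n (λ i → z * f i) ≡ z * sumFin n f
sumFin-* zero z f = sym (ℤP.*-zeroʳ z)
sumFin-* (suc n) z f =
  trans (cong (_+_ (z * f fzero)) (sumFin-* n z _)) (sym (ℤP.*-distribˡ-+ z _ _))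

sumFin-neg : ∀ n (f : Fin n → ℤ) → sumFin n (λ i → - f i) ≡ - sumFin n f
sumFin-neg zero f = refl
sumFin-neg (suc n) f =
  trans (cong (_+_ (- f fzero)) (sumFin-neg n _)) (sym (ℤP.neg-distrib-+ (f fzero) _))

sumFin-zero : ∀ n (f : Fin n → ℤ) → (∀ i → f i ≡ + 0) → sumFin n f ≡ + 0
sumFin-zero zero f h = refl
sumFin-zero (suc n) f h = cong₂ _+_ (h fzero) (sumFin-zero n _ (λ i → h (fsuc i)))

sumFin-punchIn : ∀ n (a : Fin (suc n)) (f : Fin (suc n) → ℤ) →
  sumFin (suc n) f ≡ f a + sumFin n (λ b → f (punchIn a b))
sumFin-punchIn n fzero f = refl
sumFin-punchIn (suc n) (fsuc a) f =
  trans (cong (_+_ (f fzero)) (sumFin-punchIn n a (λ i → f (fsuc i))))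
        (left-comm (f fzero) (f (fsuc a)) _)
  where
  left-comm : ∀ x y z → x + (y + z) ≡ y + (x + z)
  left-comm = solve-∀

sumFin-swap : ∀ n m (f : Fin n → Fin m → ℤ) →
  sumFin n (λ a → sumFin m (f a)) ≡ sumFin m (λ c → sumFin n (λ a → f a c))
sumFin-swap zero m f = sym (sumFin-zero m _ (λ _ → refl))
sumFin-swap (suc n) m f =
  trans (cong (_+_ (sumFin m (f fzero))) (sumFin-swap n m (λ a → f (fsuc a))))
        (sym (sumFin-+ m _ _))

sumFin-single : ∀ n (a : Fin n) (f : Fin n → ℤ) → (∀ b → b ≢ a → f b ≡ + 0) →
  sumFin n f ≡ f a
sumFin-single (suc n) a f h = begin
  sumFin (suc n) f                          ≡⟨ sumFin-punchIn n a f ⟩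
  f a + sumFin n (λ b → f (punchIn a b))    ≡⟨ cong (_+_ (f a)) (sumFin-zero n _ (λ b → h _ (FP.punchInᵢ≢i a b))) ⟩
  f a + + 0                                 ≡⟨ ℤP.+-identityʳ (f a) ⟩
  f a                                       ∎
  where open ≡-Reasoning

-- Determinants

Mat : ℕ → Set
Mat N = Fin N → Fin N → ℤ

minor : ∀ {N} → Mat (suc N) → Fin (suc N) → Mat N
minor M j r c = M (fsuc r) (punchIn j c)

laplaceTerm : ∀ {N} → Mat (suc N) → Fin (suc N) → ℤ
laplaceTerm {N} M j = sgn (toℕ j) * (M fzero j * det N (minor M j))

det-cong : ∀ N {M M′ : Mat N} → (∀ r c → M r c ≡ M′ r c) → det N M ≡ det N M′
det-cong zero h = refl
det-cong (suc N) h = sumFin-cong (suc N) (λ j →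
  cong₂ (λ x y → sgn (toℕ j) * (x * y)) (h fzero j)
    (det-cong N (λ r c → h (fsuc r) (punchIn j c))))

punchIn-punchOut-comm : ∀ {n} (a c : Fin (suc (suc n))) (a≢c : a ≢ c) (c≢a : c ≢ a) (x : Fin n) →
  punchIn a (punchIn (punchOut a≢c) x) ≡ punchIn c (punchIn (punchOut c≢a) x)
punchIn-punchOut-comm fzero fzero a≢c c≢a x = ⊥-elim (a≢c refl)
punchIn-punchOut-comm fzero (fsuc c) a≢c c≢a x = refl
punchIn-punchOut-comm (fsuc a) fzero a≢c c≢a x = refl
punchIn-punchOut-comm {suc n} (fsuc a) (fsuc c) a≢c c≢a fzero = refl
punchIn-punchOut-comm {suc n} (fsuc a) (fsuc c) a≢c c≢a (fsuc x) =
  cong fsuc (punchIn-punchOut-comm a c (λ e → a≢c (cong fsuc e)) (λ e → c≢a (cong fsuc e)) x)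

sgn-punchOut-antisym : ∀ {n} (a c : Fin (suc (suc n))) (a≢c : a ≢ c) (c≢a : c ≢ a) →
  sgn (toℕ a) * sgn (toℕ (punchOut a≢c)) ≡ - (sgn (toℕ c) * sgn (toℕ (punchOut c≢a)))
sgn-punchOut-antisym fzero fzero a≢c c≢a = ⊥-elim (a≢c refl)
sgn-punchOut-antisym fzero (fsuc c) a≢c c≢a = sign-flip _
  where
  sign-flip : ∀ s → + 1 * s ≡ - ((- s) * + 1)
  sign-flip = solve-∀
sgn-punchOut-antisym (fsuc a) fzero a≢c c≢a = sign-flip _
  where
  sign-flip : ∀ s → (- s) * + 1 ≡ - (+ 1 * s)
  sign-flip = solve-∀
sgn-punchOut-antisym {zero} (fsuc fzero) (fsuc fzero) a≢c c≢a = ⊥-elim (a≢c refl)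
sgn-punchOut-antisym {suc n} (fsuc a) (fsuc c) a≢c c≢a =
  trans (neg-*-neg (sgn (toℕ a)) _)
   (trans (sgn-punchOut-antisym a c (λ e → a≢c (cong fsuc e)) (λ e → c≢a (cong fsuc e)))
          (cong -_ (sym (neg-*-neg (sgn (toℕ c)) _))))
  where
  neg-*-neg : ∀ x y → (- x) * (- y) ≡ x * y
  neg-*-neg = solve-∀

-- Expanding along the first row and then along the first row of each minor writes det M as a
-- double sum over the pair (a, c) of columns used by rows 0 and 1; the diagonal terms are 0.
module TwoRowExpansion {N : ℕ} (M : Mat (suc (suc N))) where
  lower : (a c : Fin (suc (suc N))) → a ≢ c → ℤ
  lower a c a≢c = det N (λ r x → M (fsuc (fsuc r)) (punchIn a (punchIn (punchOut a≢c) x)))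

  term : Fin (suc (suc N)) → Fin (suc (suc N)) → ℤ
  term a c with a FP.≟ c
  ... | yes _ = + 0
  ... | no a≢c =
    (sgn (toℕ a) * sgn (toℕ (punchOut a≢c))) * ((M fzero a * M (fsuc fzero) c) * lower a c a≢c)

  term-diagonal : ∀ a → term a a ≡ + 0
  term-diagonal a with a FP.≟ a
  ... | yes _ = refl
  ... | no a≢a = ⊥-elim (a≢a refl)

  laplaceTerm≡Σterm : ∀ a → laplaceTerm M a ≡ sumFin (suc (suc N)) (term a)
  laplaceTerm≡Σterm a = begin
    sgn (toℕ a) * (M fzero a * sumFin (suc N) (λ b → laplaceTerm (minor M a) b))
      ≡⟨ cong (sgn (toℕ a) *_) (sym (sumFin-* (suc N) (M fzero a) (laplaceTerm (minor M a)))) ⟩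
    sgn (toℕ a) * sumFin (suc N) (λ b → M fzero a * laplaceTerm (minor M a) b)
      ≡⟨ sym (sumFin-* (suc N) (sgn (toℕ a)) (λ b → M fzero a * laplaceTerm (minor M a) b)) ⟩
    sumFin (suc N) (λ b → sgn (toℕ a) * (M fzero a * laplaceTerm (minor M a) b))
      ≡⟨ sumFin-cong (suc N) termAt ⟩
    sumFin (suc N) (λ b → term a (punchIn a b))
      ≡⟨ sym (ℤP.+-identityˡ _) ⟩
    + 0 + sumFin (suc N) (λ b → term a (punchIn a b))
      ≡⟨ cong (_+ sumFin (suc N) (λ b → term a (punchIn a b))) (sym (term-diagonal a)) ⟩
    term a a + sumFin (suc N) (λ b → term a (punchIn a b))
      ≡⟨ sym (sumFin-punchIn (suc N) a (term a)) ⟩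
    sumFin (suc (suc N)) (term a) ∎
    where
    open ≡-Reasoning
    regroup : ∀ sa sb x y e → sa * (x * (sb * (y * e))) ≡ (sa * sb) * ((x * y) * e)
    regroup = solve-∀
    termAt : ∀ b → sgn (toℕ a) * (M fzero a * laplaceTerm (minor M a) b) ≡ term a (punchIn a b)
    termAt b with a FP.≟ punchIn a b
    ... | yes a≡ = ⊥-elim (FP.punchInᵢ≢i a b (sym a≡))
    ... | no a≢c =
      trans (regroup (sgn (toℕ a)) (sgn (toℕ b)) (M fzero a) (M (fsuc fzero) (punchIn a b)) _)
        (cong (λ y → (sgn (toℕ a) * sgn (toℕ y)) * ((M fzero a * M (fsuc fzero) (punchIn a b)) *
                 det N (λ r x → M (fsuc (fsuc r)) (punchIn a (punchIn y x)))))
              (sym (trans (FP.punchOut-cong a refl) (FP.punchOut-punchIn a))))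

  det≡Σterm : det (suc (suc N)) M ≡ sumFin (suc (suc N)) (λ a → sumFin (suc (suc N)) (term a))
  det≡Σterm = sumFin-cong (suc (suc N)) laplaceTerm≡Σterm

swap₀₁ : ∀ {N} → Fin (suc (suc N)) → Fin (suc (suc N))
swap₀₁ fzero = fsuc fzero
swap₀₁ (fsuc fzero) = fzero
swap₀₁ (fsuc (fsuc r)) = fsuc (fsuc r)

term-swap₀₁ : ∀ {N} (M : Mat (suc (suc N))) a c →
  TwoRowExpansion.term (λ r → M (swap₀₁ r)) a c ≡ - TwoRowExpansion.term M c a
term-swap₀₁ {N} M a c with a FP.≟ c | c FP.≟ a
... | yes _ | yes _ = refl
... | yes a≡c | no c≢a = ⊥-elim (c≢a (sym a≡c))
... | no a≢c | yes c≡a = ⊥-elim (a≢c (sym c≡a))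
... | no a≢c | no c≢a = begin
    (sgn (toℕ a) * sgn (toℕ (punchOut a≢c))) * ((M (fsuc fzero) a * M fzero c) * lower a c a≢c)
      ≡⟨ cong₂ (λ s d → s * ((M (fsuc fzero) a * M fzero c) * d))
           (sgn-punchOut-antisym a c a≢c c≢a)
           (det-cong N (λ r x → cong (M (fsuc (fsuc r))) (punchIn-punchOut-comm a c a≢c c≢a x))) ⟩
    (- s) * ((M (fsuc fzero) a * M fzero c) * lower c a c≢a)
      ≡⟨ neg-swap s (M (fsuc fzero) a) (M fzero c) (lower c a c≢a) ⟩
    - (s * ((M fzero c * M (fsuc fzero) a) * lower c a c≢a)) ∎
  where
  open ≡-Reasoning
  open TwoRowExpansion M using (lower)
  s = sgn (toℕ c) * sgn (toℕ (punchOut c≢a))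
  neg-swap : ∀ s x y d → (- s) * ((x * y) * d) ≡ - (s * ((y * x) * d))
  neg-swap = solve-∀

det-swap₀₁ : ∀ N (M : Mat (suc (suc N))) →
  det (suc (suc N)) (λ r → M (swap₀₁ r)) ≡ - det (suc (suc N)) M
det-swap₀₁ N M = begin
  det (suc (suc N)) (λ r → M (swap₀₁ r))
    ≡⟨ TwoRowExpansion.det≡Σterm (λ r → M (swap₀₁ r)) ⟩
  Σ (λ a → Σ (λ c → TwoRowExpansion.term (λ r → M (swap₀₁ r)) a c))
    ≡⟨ sumFin-cong _ (λ a → sumFin-cong _ (term-swap₀₁ M a)) ⟩
  Σ (λ a → Σ (λ c → - term c a))
    ≡⟨ sumFin-cong _ (λ a → sumFin-neg _ (λ c → term c a)) ⟩
  Σ (λ a → - Σ (λ c → term c a))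
    ≡⟨ sumFin-neg _ (λ a → Σ (λ c → term c a)) ⟩
  - Σ (λ a → Σ (λ c → term c a))
    ≡⟨ cong -_ (sumFin-swap _ _ (λ a c → term c a)) ⟩
  - Σ (λ c → Σ (term c))
    ≡⟨ cong -_ (sym det≡Σterm) ⟩
  - det (suc (suc N)) M ∎
  where
  open ≡-Reasoning
  open TwoRowExpansion M using (term; det≡Σterm)
  Σ = sumFin (suc (suc N))

det-equal-top-rows : ∀ N (M : Mat (suc (suc N))) → (∀ c → M fzero c ≡ M (fsuc fzero) c) →
  det (suc (suc N)) M ≡ + 0
det-equal-top-rows N M h = x≡-x⇒x≡0 _ (trans (sym (det-cong (suc (suc N)) swap≗)) (det-swap₀₁ N M))
  where
  swap≗ : ∀ r c → M (swap₀₁ r) c ≡ M r c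
  swap≗ fzero c = sym (h c)
  swap≗ (fsuc fzero) c = h c
  swap≗ (fsuc (fsuc r)) c = refl

toTop : ∀ {N} → Fin (suc N) → Fin (suc N) → Fin (suc N)
toTop r fzero = r
toTop r (fsuc i) = punchIn r i

toSecond : ∀ {N} → Fin (suc N) → Fin (suc (suc N)) → Fin (suc (suc N))
toSecond r fzero = fzero
toSecond r (fsuc i) = fsuc (toTop r i)

mutual
  det-toTop : ∀ N (r : Fin (suc N)) (M : Mat (suc N)) →
    det (suc N) (λ q → M (toTop r q)) ≡ sgn (toℕ r) * det (suc N) M
  det-toTop N fzero M = trans (det-cong (suc N) same) (sym (ℤP.*-identityˡ (det (suc N) M)))
    where
    same : ∀ q c → M (toTop fzero q) c ≡ M q c
    same fzero c = refl
    same (fsuc q) c = refl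
  det-toTop (suc N) (fsuc r) M = begin
    det (suc (suc N)) (λ q → M (toTop (fsuc r) q))
      ≡⟨ det-cong (suc (suc N)) viaSecond ⟩
    det (suc (suc N)) (λ q → M (toSecond r (swap₀₁ q)))
      ≡⟨ det-swap₀₁ N (λ q → M (toSecond r q)) ⟩
    - det (suc (suc N)) (λ q → M (toSecond r q))
      ≡⟨ cong -_ (det-toSecond N r M) ⟩
    - (sgn (toℕ r) * det (suc (suc N)) M)
      ≡⟨ ℤP.neg-distribˡ-* (sgn (toℕ r)) _ ⟩
    - sgn (toℕ r) * det (suc (suc N)) M ∎
    where
    open ≡-Reasoning
    viaSecond : ∀ q c → M (toTop (fsuc r) q) c ≡ M (toSecond r (swap₀₁ q)) c
    viaSecond fzero c = refl
    viaSecond (fsuc fzero) c = refl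
    viaSecond (fsuc (fsuc q)) c = refl

  det-toSecond : ∀ N (r : Fin (suc N)) (M : Mat (suc (suc N))) →
    det (suc (suc N)) (λ q → M (toSecond r q)) ≡ sgn (toℕ r) * det (suc (suc N)) M
  det-toSecond N r M =
    trans (sumFin-cong (suc (suc N)) (λ j →
        trans (cong (λ d → sgn (toℕ j) * (M fzero j * d)) (det-toTop N r (minor M j)))
              (left-comm (sgn (toℕ j)) (M fzero j) (sgn (toℕ r)) _)))
      (sumFin-* (suc (suc N)) (sgn (toℕ r)) (laplaceTerm M))
    where
    left-comm : ∀ s x r d → s * (x * (r * d)) ≡ r * (s * (x * d))
    left-comm = solve-∀

det-equal-rows : ∀ N (M : Mat N) (l r : Fin N) → l ≢ r → (∀ c → M l c ≡ M r c) → det N M ≡ + 0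
det-equal-rows (suc zero) M fzero fzero l≢r h = ⊥-elim (l≢r refl)
det-equal-rows (suc (suc N)) M l r l≢r h =
  sgn-*-cancel (toℕ r) _ (sgn-*-cancel (toℕ i) _ (begin
    sgn (toℕ i) * (sgn (toℕ r) * det (suc (suc N)) M)
      ≡⟨ cong (sgn (toℕ i) *_) (sym (det-toTop (suc N) r M)) ⟩
    sgn (toℕ i) * det (suc (suc N)) X
      ≡⟨ sym (det-toSecond N i X) ⟩
    det (suc (suc N)) (λ q → X (toSecond i q))
      ≡⟨ det-equal-top-rows N (λ q → X (toSecond i q)) topRows ⟩
    + 0 ∎))
  where
  open ≡-Reasoning
  X : Mat (suc (suc N))
  X q = M (toTop r q)
  r≢l : r ≢ l
  r≢l e = l≢r (sym e)
  i : Fin (suc N)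
  i = punchOut r≢l
  topRows : ∀ c → M r c ≡ M (punchIn r i) c
  topRows c = trans (sym (h c)) (cong (λ t → M t c) (sym (FP.punchIn-punchOut r≢l)))

mutual
  det-linear : ∀ N (r : Fin N) (M M₁ M₂ : Mat N) (z : ℤ) →
    (∀ i → i ≢ r → ∀ c → M i c ≡ M₁ i c) → (∀ i → i ≢ r → ∀ c → M i c ≡ M₂ i c) →
    (∀ c → M r c ≡ M₁ r c + z * M₂ r c) → det N M ≡ det N M₁ + z * det N M₂
  det-linear (suc N) r M M₁ M₂ z h₁ h₂ hr = begin
    sumFin (suc N) (laplaceTerm M)
      ≡⟨ sumFin-cong (suc N) (laplaceTerm-linear N r M M₁ M₂ z h₁ h₂ hr) ⟩
    sumFin (suc N) (λ j → laplaceTerm M₁ j + z * laplaceTerm M₂ j)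
      ≡⟨ sumFin-+ (suc N) (laplaceTerm M₁) (λ j → z * laplaceTerm M₂ j) ⟩
    det (suc N) M₁ + sumFin (suc N) (λ j → z * laplaceTerm M₂ j)
      ≡⟨ cong (_+_ (det (suc N) M₁)) (sumFin-* (suc N) z (laplaceTerm M₂)) ⟩
    det (suc N) M₁ + z * det (suc N) M₂ ∎
    where open ≡-Reasoning

  laplaceTerm-linear : ∀ N (r : Fin (suc N)) (M M₁ M₂ : Mat (suc N)) (z : ℤ) →
    (∀ i → i ≢ r → ∀ c → M i c ≡ M₁ i c) → (∀ i → i ≢ r → ∀ c → M i c ≡ M₂ i c) →
    (∀ c → M r c ≡ M₁ r c + z * M₂ r c) →
    ∀ j → laplaceTerm M j ≡ laplaceTerm M₁ j + z * laplaceTerm M₂ j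
  laplaceTerm-linear N fzero M M₁ M₂ z h₁ h₂ hr j =
    trans (cong₂ (λ x d → sgn (toℕ j) * (x * d)) (hr j) (det-cong N (λ r c → h₁ (fsuc r) (λ ()) (punchIn j c))))
      (trans (distrib (sgn (toℕ j)) (M₁ fzero j) (M₂ fzero j) z (det N (minor M₁ j)))
        (cong (λ d → laplaceTerm M₁ j + z * (sgn (toℕ j) * (M₂ fzero j * d)))
          (det-cong N (λ r c → trans (sym (h₁ (fsuc r) (λ ()) (punchIn j c))) (h₂ (fsuc r) (λ ()) (punchIn j c))))))
    where
    distrib : ∀ s x y z d → s * ((x + z * y) * d) ≡ s * (x * d) + z * (s * (y * d))
    distrib = solve-∀
  laplaceTerm-linear N (fsuc r) M M₁ M₂ z h₁ h₂ hr j =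
    trans (cong (λ d → sgn (toℕ j) * (M fzero j * d))
            (det-linear N r (minor M j) (minor M₁ j) (minor M₂ j) z
              (λ i i≢r c → h₁ (fsuc i) (λ e → i≢r (FP.suc-injective e)) (punchIn j c))
              (λ i i≢r c → h₂ (fsuc i) (λ e → i≢r (FP.suc-injective e)) (punchIn j c))
              (λ c → hr (punchIn j c))))
      (trans (distrib (sgn (toℕ j)) (M fzero j) z (det N (minor M₁ j)) (det N (minor M₂ j)))
        (cong₂ (λ x y → sgn (toℕ j) * (x * det N (minor M₁ j)) + z * (sgn (toℕ j) * (y * det N (minor M₂ j))))
          (h₁ fzero (λ ()) j) (h₂ fzero (λ ()) j)))
    where
    distrib : ∀ s x z d₁ d₂ → s * (x * (d₁ + z * d₂)) ≡ s * (x * d₁) + z * (s * (x * d₂))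
    distrib = solve-∀

replaceRow : ∀ {N} → Mat N → Fin N → (Fin N → ℤ) → Mat N
replaceRow M r v i c with i FP.≟ r
... | yes _ = v c
... | no _ = M i c

replaceRow-≡ : ∀ {N} (M : Mat N) r v c → replaceRow M r v r c ≡ v c
replaceRow-≡ M r v c with r FP.≟ r
... | yes _ = refl
... | no r≢r = ⊥-elim (r≢r refl)

replaceRow-≢ : ∀ {N} (M : Mat N) r v i c → i ≢ r → replaceRow M r v i c ≡ M i c
replaceRow-≢ M r v i c i≢r with i FP.≟ r
... | yes i≡r = ⊥-elim (i≢r i≡r)
... | no _ = refl

det-addRowMultiple : ∀ N (M M′ : Mat N) (r l : Fin N) (z : ℤ) → l ≢ r →
  (∀ i → i ≢ r → ∀ c → M′ i c ≡ M i c) → (∀ c → M′ r c ≡ M r c + z * M l c) →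
  det N M′ ≡ det N M
det-addRowMultiple N M M′ r l z l≢r same hr = begin
  det N M′
    ≡⟨ det-linear N r M′ M L z same
         (λ i i≢r c → trans (same i i≢r c) (sym (replaceRow-≢ M r (M l) i c i≢r)))
         (λ c → trans (hr c) (cong (λ t → M r c + z * t) (sym (replaceRow-≡ M r (M l) c)))) ⟩
  det N M + z * det N L
    ≡⟨ cong (λ t → det N M + z * t) (det-equal-rows N L l r l≢r
         (λ c → trans (replaceRow-≢ M r (M l) l c l≢r) (sym (replaceRow-≡ M r (M l) c)))) ⟩
  det N M + z * + 0
    ≡⟨ cong (_+_ (det N M)) (ℤP.*-zeroʳ z) ⟩
  det N M + + 0
    ≡⟨ ℤP.+-identityʳ (det N M) ⟩
  det N M ∎
  where
  open ≡-Reasoning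
  L : Mat N
  L = replaceRow M r (M l)

-- The rows r satisfying P receive z times row σ r, which itself does not satisfy P. Stage t is
-- the matrix in which only the rows with index below t have been treated so far.
module AddRowMultiples {N : ℕ} (M : Mat N) (P : Fin N → Set) (P? : ∀ r → Dec (P r))
                       (σ : Fin N → Fin N) (z : ℤ) (σ∉P : ∀ r → P r → ¬ P (σ r)) where
  Added Kept : Mat N → Fin N → Set
  Added M′ r = ∀ c → M′ r c ≡ M r c + z * M (σ r) c
  Kept M′ r = ∀ c → M′ r c ≡ M r c

  record Stage (t : ℕ) (M′ : Mat N) : Set where
    field
      added : ∀ r → P r → toℕ r < t → Added M′ r
      kept : ∀ r → ¬ P r ⊎ t ℕ.≤ toℕ r → Kept M′ r
  open Stage

  stage-lower : ∀ t M′ M″ → Stage (suc t) M′ → (∀ r → toℕ r ≢ t → ∀ c → M″ r c ≡ M′ r c) →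
    (∀ r → toℕ r ≡ t → Kept M″ r) → Stage t M″
  stage-lower t M′ M″ st same rowT .added r p r<t c =
    trans (same r (ℕP.<⇒≢ r<t) c) (added st r p (ℕP.m≤n⇒m≤1+n r<t) c)
  stage-lower t M′ M″ st same rowT .kept r h with toℕ r ℕP.≟ t
  ... | yes r≡t = rowT r r≡t
  ... | no r≢t = λ c → trans (same r r≢t c) (kept st r (raise h) c)
    where
    raise : ¬ P r ⊎ t ℕ.≤ toℕ r → ¬ P r ⊎ suc t ℕ.≤ toℕ r
    raise (inj₁ ¬p) = inj₁ ¬p
    raise (inj₂ t≤r) = inj₂ (ℕP.≤∧≢⇒< t≤r (λ t≡r → r≢t (sym t≡r)))

  treatRow : ∀ t M′ (r₀ : Fin N) → toℕ r₀ ≡ t → Stage (suc t) M′ → P r₀ →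
    det N M′ ≡ det N (replaceRow M′ r₀ (M r₀)) × Stage t (replaceRow M′ r₀ (M r₀))
  treatRow t M′ r₀ r₀≡t st p =
    det-addRowMultiple N M″ M′ r₀ (σ r₀) z σr₀≢r₀ (λ i i≢r₀ c → sym (replaceRow-≢ M′ r₀ (M r₀) i c i≢r₀))
      (λ c → trans (added st r₀ p (ℕP.≤-reflexive (cong suc r₀≡t)) c)
               (cong₂ (λ x y → x + z * y) (sym (replaceRow-≡ M′ r₀ (M r₀) c))
                 (sym (trans (replaceRow-≢ M′ r₀ (M r₀) (σ r₀) c σr₀≢r₀) (kept st (σ r₀) (inj₁ (σ∉P r₀ p)) c)))))
    , stage-lower t M′ M″ st (λ r r≢t c → replaceRow-≢ M′ r₀ (M r₀) r c (λ { refl → r≢t r₀≡t }))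
        (λ r r≡t → subst (Kept M″) (FP.toℕ-injective (trans r₀≡t (sym r≡t))) (replaceRow-≡ M′ r₀ (M r₀)))
    where
    M″ = replaceRow M′ r₀ (M r₀)
    σr₀≢r₀ : σ r₀ ≢ r₀
    σr₀≢r₀ e = σ∉P r₀ p (subst P (sym e) p)

  det-stage : ∀ t M′ → Stage t M′ → det N M′ ≡ det N M
  det-stage zero M′ st = det-cong N (λ r → kept st r (inj₂ z≤n))
  det-stage (suc t) M′ st with t ℕP.<? N
  ... | no t≮N = det-stage t M′ (stage-lower t M′ M′ st (λ _ _ _ → refl)
                   (λ r r≡t → ⊥-elim (t≮N (subst (_< N) r≡t (FP.toℕ<n r)))))
  ... | yes t<N = byRow (P? r₀)
    where
    r₀ = F.fromℕ< t<N
    r₀≡t : toℕ r₀ ≡ t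
    r₀≡t = FP.toℕ-fromℕ< t<N
    byRow : Dec (P r₀) → det N M′ ≡ det N M
    byRow (no ¬p) = det-stage t M′ (stage-lower t M′ M′ st (λ _ _ _ → refl)
      (λ r r≡t → kept st r (inj₁ (λ p → ¬p (subst P (FP.toℕ-injective (trans r≡t (sym r₀≡t))) p)))))
    byRow (yes p) with treatRow t M′ r₀ r₀≡t st p
    ... | det≡ , st′ = trans det≡ (det-stage t _ st′)

det-addRowMultiples : ∀ N (M M′ : Mat N) (P : Fin N → Set) (P? : ∀ r → Dec (P r))
  (σ : Fin N → Fin N) (z : ℤ) → (∀ r → P r → ¬ P (σ r)) →
  (∀ r c → P r → M′ r c ≡ M r c + z * M (σ r) c) → (∀ r c → ¬ P r → M′ r c ≡ M r c) →
  det N M′ ≡ det N M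
det-addRowMultiples N M M′ P P? σ z σ∉P added fixed = det-stage N M′ (record
  { added = λ r p _ c → added r c p
  ; kept = λ { r (inj₁ ¬p) c → fixed r c ¬p ; r (inj₂ N≤r) → ⊥-elim (ℕP.<⇒≱ (FP.toℕ<n r) N≤r) } })
  where open AddRowMultiples M P P? σ z σ∉P

mutual
  det-zero-column : ∀ N (M : Mat N) c → (∀ r → M r c ≡ + 0) → det N M ≡ + 0
  det-zero-column (suc N) M c zero-c = sumFin-zero (suc N) (laplaceTerm M) termZero
    where
    termZero : ∀ j → laplaceTerm M j ≡ + 0
    termZero j with j FP.≟ c
    ... | yes refl = trans (cong (λ x → sgn (toℕ j) * (x * det N (minor M j))) (zero-c fzero))
                       (ℤP.*-zeroʳ (sgn (toℕ j)))
    ... | no j≢c = laplaceTerm-zero-column M j c j≢c (λ r → zero-c (fsuc r))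

  laplaceTerm-zero-column : ∀ {N} (M : Mat (suc N)) j c → j ≢ c → (∀ r → M (fsuc r) c ≡ + 0) →
    laplaceTerm M j ≡ + 0
  laplaceTerm-zero-column {N} M j c j≢c zero-c =
    trans (cong (λ d → sgn (toℕ j) * (M fzero j * d))
            (det-zero-column N (minor M j) (punchOut j≢c)
              (λ r → trans (cong (M (fsuc r)) (FP.punchIn-punchOut j≢c)) (zero-c r))))
      (trans (cong (sgn (toℕ j) *_) (ℤP.*-zeroʳ (M fzero j))) (ℤP.*-zeroʳ (sgn (toℕ j))))

det-lone-entry : ∀ N (M : Mat (suc N)) (r c : Fin (suc N)) → (∀ i → i ≢ r → M i c ≡ + 0) →
  det (suc N) M ≡ sgn (toℕ r) * (sgn (toℕ c) * (M r c * det N (λ i x → M (punchIn r i) (punchIn c x))))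
det-lone-entry N M r c lone = begin
  det (suc N) M
    ≡⟨ sym (sgn-involutive (toℕ r) (det (suc N) M)) ⟩
  sgn (toℕ r) * (sgn (toℕ r) * det (suc N) M)
    ≡⟨ cong (sgn (toℕ r) *_) (sym (det-toTop N r M)) ⟩
  sgn (toℕ r) * sumFin (suc N) (laplaceTerm X)
    ≡⟨ cong (sgn (toℕ r) *_) (sumFin-single (suc N) c (laplaceTerm X) otherTerms) ⟩
  sgn (toℕ r) * laplaceTerm X c ∎
  where
  open ≡-Reasoning
  X : Mat (suc N)
  X q = M (toTop r q)
  otherTerms : ∀ j → j ≢ c → laplaceTerm X j ≡ + 0
  otherTerms j j≢c = laplaceTerm-zero-column X j c j≢c (λ q → lone (punchIn r q) (FP.punchInᵢ≢i r q))

det-lone-unit : ∀ N (M : Mat (suc N)) (r c : Fin (suc N)) →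
  (∀ i → i ≢ r → M i c ≡ + 0) → IsUnit (M r c) →
  det (suc N) M ≈± det N (λ i x → M (punchIn r i) (punchIn c x))
det-lone-unit N M r c lone unit =
  ≈±-trans (inj₁ (trans (det-lone-entry N M r c lone) (assoc (sgn (toℕ r)) (sgn (toℕ c)) (M r c) D)))
    (unit-*-≈± (isUnit-* (isUnit-sgn (toℕ r)) (isUnit-* (isUnit-sgn (toℕ c)) unit)) D)
  where
  D : ℤ
  D = det N (λ i x → M (punchIn r i) (punchIn c x))
  assoc : ∀ a b u d → a * (b * (u * d)) ≡ (a * (b * u)) * d
  assoc = solve-∀

-- Coefficient functions and Sylvester matrices

Poly : Set
Poly = ℕ → ℤ

DegreeAtMost : ℕ → Poly → Set
DegreeAtMost d P = ∀ i → d < i → P i ≡ + 0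

shift : ℕ → Poly → Poly
shift zero P = P
shift (suc s) P zero = + 0
shift (suc s) P (suc i) = shift s P i

dropConstant : Poly → Poly
dropConstant P i = P (suc i)

shift-cong : ∀ s {P Q : Poly} → (∀ i → P i ≡ Q i) → ∀ i → shift s P i ≡ shift s Q i
shift-cong zero P≗Q i = P≗Q i
shift-cong (suc s) P≗Q zero = refl
shift-cong (suc s) P≗Q (suc i) = shift-cong s P≗Q i

shift-+ : ∀ s P e → shift s P (s ℕ.+ e) ≡ P e
shift-+ zero P e = refl
shift-+ (suc s) P e = shift-+ s P e

shift-≡ : ∀ s P e i → i ≡ s ℕ.+ e → shift s P i ≡ P e
shift-≡ s P e i refl = shift-+ s P e

shift-< : ∀ s P i → i < s → shift s P i ≡ + 0
shift-< (suc s) P zero _ = refl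
shift-< (suc s) P (suc i) (s≤s i<s) = shift-< s P i i<s

shift-degree : ∀ s d P → DegreeAtMost d P → DegreeAtMost (s ℕ.+ d) (shift s P)
shift-degree zero d P degP = degP
shift-degree (suc s) d P degP (suc i) (s≤s s+d<i) = shift-degree s d P degP i s+d<i

shift-shift : ∀ a b P i → shift a (shift b P) i ≡ shift (a ℕ.+ b) P i
shift-shift zero b P i = refl
shift-shift (suc a) b P zero = refl
shift-shift (suc a) b P (suc i) = shift-shift a b P i

shift-linear : ∀ s (A B : Poly) z i → shift s (λ i → A i + z * B i) i ≡ shift s A i + z * shift s B i
shift-linear zero A B z i = refl
shift-linear (suc s) A B z zero = sym (trans (ℤP.+-identityˡ _) (ℤP.*-zeroʳ z))
shift-linear (suc s) A B z (suc i) = shift-linear s A B z i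

shift-constant : ∀ s (B : Poly) → B 0 ≡ + 0 → shift s B 0 ≡ + 0
shift-constant zero B B₀≡0 = B₀≡0
shift-constant (suc s) B B₀≡0 = refl

shift-dropConstant : ∀ s (B : Poly) → B 0 ≡ + 0 → ∀ i → shift s B (suc i) ≡ shift s (dropConstant B) i
shift-dropConstant zero B B₀≡0 i = refl
shift-dropConstant (suc s) B B₀≡0 zero = shift-constant s B B₀≡0
shift-dropConstant (suc s) B B₀≡0 (suc i) = shift-dropConstant s B B₀≡0 i

δ-refl : ∀ a → δ a a ≡ + 1
δ-refl zero = refl
δ-refl (suc a) = δ-refl a

δ-≢ : ∀ a i → i ≢ a → δ a i ≡ + 0
δ-≢ zero zero i≢a = ⊥-elim (i≢a refl)
δ-≢ zero (suc i) i≢a = refl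
δ-≢ (suc a) zero i≢a = refl
δ-≢ (suc a) (suc i) i≢a = δ-≢ a i (λ e → i≢a (cong suc e))

δ-degree : ∀ a → DegreeAtMost a (δ a)
δ-degree a i a<i = δ-≢ a i (ℕP.>⇒≢ a<i)

shift-δ : ∀ s e i → shift s (δ e) i ≡ δ (s ℕ.+ e) i
shift-δ zero e i = refl
shift-δ (suc s) e zero = refl
shift-δ (suc s) e (suc i) = shift-δ s e i

data Cut (α i : ℕ) : Set where
  left : ∀ h → α ≡ suc i ℕ.+ h → Cut α i
  right : ∀ t → i ≡ α ℕ.+ t → Cut α i

cut : ∀ α i → Cut α i
cut zero i = right i refl
cut (suc α) zero = left α refl
cut (suc α) (suc i) with cut α i
... | left h e = left h (cong suc e)
... | right t e = right t (cong suc e)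

sylvesterRow : (α β : ℕ) → Poly → Poly → ℕ → Poly
sylvesterRow α β A B i = if i ℕ.<ᵇ α then shift (α ∸ suc i) A else shift (β ∸ suc (i ∸ α)) B

-- Column c holds the coefficients of x^(N-1-c). The size N is kept apart from α + β so that it
-- can be rewritten independently of the row counts.
Syl : (N α β : ℕ) → Poly → Poly → Mat N
Syl N α β A B r c = sylvesterRow α β A B (toℕ r) (N ∸ suc (toℕ c))

Res : (N α β : ℕ) → Poly → Poly → ℤ
Res N α β A B = det N (Syl N α β A B)

<ᵇ-true : ∀ {m n} → m < n → (m ℕ.<ᵇ n) ≡ true
<ᵇ-true m<n = Equivalence.to T-≡ (ℕP.<⇒<ᵇ m<n)

<ᵇ-false : ∀ {m n} → n ℕ.≤ m → (m ℕ.<ᵇ n) ≡ false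
<ᵇ-false {m} {n} n≤m with m ℕ.<ᵇ n in eq
... | false = refl
... | true = ⊥-elim (ℕP.<⇒≱ (ℕP.<ᵇ⇒< m n (subst T (sym eq) _)) n≤m)

sylvesterRow-A : ∀ α β A B i → i < α → sylvesterRow α β A B i ≡ shift (α ∸ suc i) A
sylvesterRow-A α β A B i i<α rewrite <ᵇ-true i<α = refl

sylvesterRow-B : ∀ α β A B i → α ℕ.≤ i → sylvesterRow α β A B i ≡ shift (β ∸ suc (i ∸ α)) B
sylvesterRow-B α β A B i α≤i rewrite <ᵇ-false α≤i = refl

sylvesterRow-left : ∀ α β A B i h → α ≡ suc i ℕ.+ h → ∀ e → sylvesterRow α β A B i e ≡ shift h A e
sylvesterRow-left α β A B i h refl e =
  trans (cong (λ P → P e) (sylvesterRow-A α β A B i (s≤s (ℕP.m≤m+n i h))))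
        (cong (λ s → shift s A e) (ℕP.m+n∸m≡n (suc i) h))

sylvesterRow-right : ∀ α β A B i t → i ≡ α ℕ.+ t → ∀ e →
  sylvesterRow α β A B i e ≡ shift (β ∸ suc t) B e
sylvesterRow-right α β A B i t refl e =
  trans (cong (λ P → P e) (sylvesterRow-B α β A B (α ℕ.+ t) (ℕP.m≤m+n α t)))
        (cong (λ x → shift (β ∸ suc x) B e) (ℕP.m+n∸m≡n α t))

Res-cong : ∀ N α β {A A′ B B′} → (∀ i → A i ≡ A′ i) → (∀ i → B i ≡ B′ i) →
  Res N α β A B ≡ Res N α β A′ B′
Res-cong N α β A≗A′ B≗B′ = det-cong N entry
  where
  entry : ∀ r c → Syl N α β _ _ r c ≡ Syl N α β _ _ r c
  entry r c with toℕ r ℕ.<ᵇ α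
  ... | true = shift-cong (α ∸ suc (toℕ r)) A≗A′ _
  ... | false = shift-cong (β ∸ suc (toℕ r ∸ α)) B≗B′ _

sylvesterRow-A-at : ∀ α β A B i h e D → α ≡ suc i ℕ.+ h → D ≡ h ℕ.+ e → sylvesterRow α β A B i D ≡ A e
sylvesterRow-A-at α β A B i h e D α≡ D≡ = trans (sylvesterRow-left α β A B i h α≡ D) (shift-≡ h A e D D≡)

sylvesterRow-B-at : ∀ α β A B i t e D → i ≡ α ℕ.+ t → D ≡ (β ∸ suc t) ℕ.+ e →
  sylvesterRow α β A B i D ≡ B e
sylvesterRow-B-at α β A B i t e D i≡ D≡ = trans (sylvesterRow-right α β A B i t i≡ D) (shift-≡ _ B e D D≡)

row-of-A : ∀ {α β i h} → α ≡ suc i ℕ.+ h → α ℕ.+ β ≡ h ℕ.+ (suc i ℕ.+ β)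
row-of-A {α} {β} {i} {h} refl = rearrange i h β
  where
  rearrange : ∀ i h β → (suc i ℕ.+ h) ℕ.+ β ≡ h ℕ.+ (suc i ℕ.+ β)
  rearrange = ℕSolver.solve-∀

row-of-B : ∀ α {β t} → t < β → α ℕ.+ β ≡ (β ∸ suc t) ℕ.+ (α ℕ.+ suc t)
row-of-B α {β} {t} t<β = begin
  α ℕ.+ β                           ≡⟨ cong (α ℕ.+_) (sym (ℕP.m∸n+n≡m t<β)) ⟩
  α ℕ.+ ((β ∸ suc t) ℕ.+ suc t)     ≡⟨ left-comm α (β ∸ suc t) (suc t) ⟩
  (β ∸ suc t) ℕ.+ (α ℕ.+ suc t)     ∎
  where
  open ≡-Reasoning
  left-comm : ∀ a b c → a ℕ.+ (b ℕ.+ c) ≡ b ℕ.+ (a ℕ.+ c)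
  left-comm = ℕSolver.solve-∀

index-of-B : ∀ α {i β t} → i < α ℕ.+ β → i ≡ α ℕ.+ t → t < β
index-of-B α i< refl = ℕP.+-cancelˡ-< α _ _ i<

toℕ-punchIn-< : ∀ {n} (r : Fin (suc n)) (i : Fin n) → toℕ i < toℕ r → toℕ (punchIn r i) ≡ toℕ i
toℕ-punchIn-< (fsuc r) fzero _ = refl
toℕ-punchIn-< (fsuc r) (fsuc i) (s≤s i<r) = cong suc (toℕ-punchIn-< r i i<r)

toℕ-punchIn-≥ : ∀ {n} (r : Fin (suc n)) (i : Fin n) → toℕ r ℕ.≤ toℕ i → toℕ (punchIn r i) ≡ suc (toℕ i)
toℕ-punchIn-≥ fzero i _ = refl
toℕ-punchIn-≥ (fsuc r) (fsuc i) (s≤s r≤i) = cong suc (toℕ-punchIn-≥ r i r≤i)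

-- Expansion along the first column, whose only nonzero entry is the leading coefficient of A.
Res-leadingA : ∀ α β A B → IsUnit (A β) → DegreeAtMost β A → DegreeAtMost α B →
  Res (suc α ℕ.+ β) (suc α) β A B ≈± Res (α ℕ.+ β) α β A B
Res-leadingA α β A B unit degA degB =
  det-lone-unit (α ℕ.+ β) (Syl (suc α ℕ.+ β) (suc α) β A B) fzero fzero lone
    (subst IsUnit (sym (shift-+ α A β)) unit)
  where
  lone : ∀ i → i ≢ fzero → Syl (suc α ℕ.+ β) (suc α) β A B i fzero ≡ + 0
  lone fzero i≢0 = ⊥-elim (i≢0 refl)
  lone (fsuc i) _ with cut α (toℕ i)
  ... | left h e = trans (sylvesterRow-A-at α β A B (toℕ i) h _ (α ℕ.+ β) e (row-of-A e))
                         (degA _ (s≤s (ℕP.m≤n+m β (toℕ i))))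
  ... | right t e = trans (sylvesterRow-B-at α β A B (toℕ i) t _ (α ℕ.+ β) e (row-of-B α (index-of-B α (FP.toℕ<n i) e)))
                          (degB _ (ℕP.m<m+n α (s≤s z≤n)))

-- The lone entry of the first column is now the leading coefficient of B, in row α.
Res-leadingB : ∀ α β A B → IsUnit (B α) → DegreeAtMost α B → DegreeAtMost β A →
  Res (suc (α ℕ.+ β)) α (suc β) A B ≈± Res (α ℕ.+ β) α β A B
Res-leadingB α β A B unit degB degA =
  ≈±-trans (det-lone-unit N M r fzero lone pivot) (inj₁ (det-cong N minor≡))
  where
  N = α ℕ.+ β
  M = Syl (suc N) α (suc β) A B
  α<1+N : α < suc N
  α<1+N = s≤s (ℕP.m≤m+n α β)
  r : Fin (suc N)
  r = F.fromℕ< α<1+N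
  r≡α : toℕ r ≡ α
  r≡α = FP.toℕ-fromℕ< α<1+N
  pivot : IsUnit (M r fzero)
  pivot = subst IsUnit (sym (sylvesterRow-B-at α (suc β) A B (toℕ r) 0 α N
                              (trans r≡α (sym (ℕP.+-identityʳ α))) (ℕP.+-comm α β))) unit
  lone : ∀ i → i ≢ r → M i fzero ≡ + 0
  lone i i≢r with cut α (toℕ i)
  ... | left h e = trans (sylvesterRow-A-at α (suc β) A B (toℕ i) h _ N e (row-of-A e))
                         (degA _ (s≤s (ℕP.m≤n+m β (toℕ i))))
  ... | right zero e = ⊥-elim (i≢r (FP.toℕ-injective (trans e (trans (ℕP.+-identityʳ α) (sym r≡α)))))
  ... | right (suc t) e =
    trans (sylvesterRow-B-at α (suc β) A B (toℕ i) (suc t) _ N e (row-of-B α t<β))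
          (degB _ (ℕP.m<m+n α (s≤s z≤n)))
    where
    t<β : t < β
    t<β = ℕ.s<s⁻¹ (index-of-B α (subst (toℕ i <_) (sym (ℕP.+-suc α β)) (FP.toℕ<n i)) e)
  minor≡ : ∀ i x → M (punchIn r i) (fsuc x) ≡ Syl N α β A B i x
  minor≡ i x with cut α (toℕ i)
  ... | left h e =
    trans (sylvesterRow-left α (suc β) A B _ h
            (trans e (cong (λ y → suc y ℕ.+ h) (sym (toℕ-punchIn-< r i (subst (toℕ i <_) (sym r≡α) i<α))))) _)
          (sym (sylvesterRow-left α β A B _ h e _))
    where
    i<α : toℕ i < α
    i<α = ℕP.m+n≤o⇒m≤o _ (ℕP.≤-reflexive (sym e))
  ... | right t e =
    trans (sylvesterRow-right α (suc β) A B _ (suc t)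
            (trans (toℕ-punchIn-≥ r i (subst (ℕ._≤ toℕ i) (sym r≡α) α≤i)) (trans (cong suc e) (sym (ℕP.+-suc α t)))) _)
          (sym (sylvesterRow-right α β A B _ t e _))
    where
    α≤i : α ℕ.≤ toℕ i
    α≤i = subst (α ℕ.≤_) (sym e) (ℕP.m≤m+n α t)

-- Expansion along the last column, whose only nonzero entry is the constant term of A, in row α.
Res-constantA : ∀ α β A B → IsUnit (A 0) → B 0 ≡ + 0 →
  Res (suc α ℕ.+ β) (suc α) β A B ≈± Res (α ℕ.+ β) α β A (dropConstant B)
Res-constantA α β A B unit B₀≡0 =
  ≈±-trans (det-lone-unit N M r c lone pivot) (inj₁ (det-cong N minor≡))
  where
  N = α ℕ.+ β
  M = Syl (suc N) (suc α) β A B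
  α<1+N : α < suc N
  α<1+N = s≤s (ℕP.m≤m+n α β)
  r c : Fin (suc N)
  r = F.fromℕ< α<1+N
  c = F.fromℕ< (ℕP.n<1+n N)
  r≡α : toℕ r ≡ α
  r≡α = FP.toℕ-fromℕ< α<1+N
  degree-c : suc N ∸ suc (toℕ c) ≡ 0
  degree-c = trans (cong (N ∸_) (FP.toℕ-fromℕ< (ℕP.n<1+n N))) (ℕP.n∸n≡0 N)
  pivot : IsUnit (M r c)
  pivot = subst IsUnit (sym (trans (cong (sylvesterRow (suc α) β A B (toℕ r)) degree-c)
            (sylvesterRow-left (suc α) β A B (toℕ r) 0 (trans (cong suc (sym r≡α)) (sym (ℕP.+-identityʳ _))) 0)))
            unit
  lone : ∀ i → i ≢ r → M i c ≡ + 0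
  lone i i≢r rewrite degree-c with cut (suc α) (toℕ i)
  ... | left zero e = ⊥-elim (i≢r (FP.toℕ-injective
          (trans (ℕP.suc-injective (trans (sym (ℕP.+-identityʳ _)) (sym e))) (sym r≡α))))
  ... | left (suc h) e = sylvesterRow-left (suc α) β A B (toℕ i) (suc h) e 0
  ... | right t e = trans (sylvesterRow-right (suc α) β A B (toℕ i) t e 0) (shift-constant (β ∸ suc t) B B₀≡0)
  minor≡ : ∀ i x → M (punchIn r i) (punchIn c x) ≡ Syl N α β A (dropConstant B) i x
  minor≡ i x rewrite toℕ-punchIn-< c x (subst (toℕ x <_) (sym (FP.toℕ-fromℕ< (ℕP.n<1+n N))) (FP.toℕ<n x))
                   | ℕP.+-∸-assoc 1 (FP.toℕ<n x)
    with cut α (toℕ i)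
  ... | left h e =
    trans (sylvesterRow-left (suc α) β A B _ (suc h)
            (trans (cong suc e) (trans (sym (ℕP.+-suc (suc (toℕ i)) h))
              (cong (λ y → suc y ℕ.+ suc h) (sym (toℕ-punchIn-< r i (subst (toℕ i <_) (sym r≡α) i<α)))))) _)
          (sym (sylvesterRow-left α β A (dropConstant B) _ h e _))
    where
    i<α : toℕ i < α
    i<α = ℕP.m+n≤o⇒m≤o _ (ℕP.≤-reflexive (sym e))
  ... | right t e =
    trans (sylvesterRow-right (suc α) β A B _ t
            (trans (toℕ-punchIn-≥ r i (subst (ℕ._≤ toℕ i) (sym r≡α) α≤i)) (cong suc e)) _)
          (trans (shift-dropConstant (β ∸ suc t) B B₀≡0 _) (sym (sylvesterRow-right α β A (dropConstant B) _ t e _)))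
    where
    α≤i : α ℕ.≤ toℕ i
    α≤i = subst (α ℕ.≤_) (sym e) (ℕP.m≤m+n α t)

-- Replacing A by A + z x^s B adds to row i of A the row of B with the same total shift
-- x^(α-1-i+s), namely row α + g + i.
sylvesterRow-reduceA : ∀ α β s g A B z i h → β ≡ α ℕ.+ s ℕ.+ g → α ≡ suc i ℕ.+ h → ∀ D →
  sylvesterRow α β (λ e → A e + z * shift s B e) B i D
    ≡ sylvesterRow α β A B i D + z * sylvesterRow α β A B (α ℕ.+ (g ℕ.+ i)) D
sylvesterRow-reduceA α β s g A B z i h β≡ α≡ D = begin
  sylvesterRow α β (λ e → A e + z * shift s B e) B i D
    ≡⟨ sylvesterRow-left α β _ B i h α≡ D ⟩
  shift h (λ e → A e + z * shift s B e) D
    ≡⟨ shift-linear h A (shift s B) z D ⟩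
  shift h A D + z * shift h (shift s B) D
    ≡⟨ cong₂ (λ a b → a + z * b) (sym (sylvesterRow-left α β A B i h α≡ D)) (shift-shift h s B D) ⟩
  sylvesterRow α β A B i D + z * shift (h ℕ.+ s) B D
    ≡⟨ cong (λ b → sylvesterRow α β A B i D + z * b)
            (sym (trans (sylvesterRow-right α β A B _ (g ℕ.+ i) refl D) (cong (λ y → shift y B D) partnerShift))) ⟩
  sylvesterRow α β A B i D + z * sylvesterRow α β A B (α ℕ.+ (g ℕ.+ i)) D ∎
  where
  open ≡-Reasoning
  rearrange : ∀ i h s g → suc i ℕ.+ h ℕ.+ s ℕ.+ g ≡ suc (g ℕ.+ i) ℕ.+ (h ℕ.+ s)
  rearrange = ℕSolver.solve-∀
  partnerShift : β ∸ suc (g ℕ.+ i) ≡ h ℕ.+ s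
  partnerShift = trans (cong (_∸ suc (g ℕ.+ i)) (trans β≡ (trans (cong (λ a → a ℕ.+ s ℕ.+ g) α≡) (rearrange i h s g))))
                       (ℕP.m+n∸m≡n (suc (g ℕ.+ i)) (h ℕ.+ s))

Res-reduceA : ∀ α β s g A B z → β ≡ α ℕ.+ s ℕ.+ g →
  Res (α ℕ.+ β) α β (λ i → A i + z * shift s B i) B ≡ Res (α ℕ.+ β) α β A B
Res-reduceA α β s g A B z β≡ =
  det-addRowMultiples N M M′ (λ r → toℕ r < α) (λ r → toℕ r ℕP.<? α) σ z σ∉A added fixed
  where
  N = α ℕ.+ β
  A′ : Poly
  A′ i = A i + z * shift s B i
  M = Syl N α β A B
  M′ = Syl N α β A′ B
  partner<N : ∀ i → i < α → α ℕ.+ (g ℕ.+ i) < N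
  partner<N i i<α = ℕP.+-monoʳ-< α (subst (g ℕ.+ i <_) (sym β≡)
    (ℕP.<-≤-trans (ℕP.+-monoʳ-< g i<α) (subst (g ℕ.+ α ℕ.≤_) (rearrange α s g) (ℕP.m≤m+n (g ℕ.+ α) s))))
    where
    rearrange : ∀ a s g → g ℕ.+ a ℕ.+ s ≡ a ℕ.+ s ℕ.+ g
    rearrange = ℕSolver.solve-∀
  σ : Fin N → Fin N
  σ r with toℕ r ℕP.<? α
  ... | yes r<α = F.fromℕ< (partner<N (toℕ r) r<α)
  ... | no _ = r
  σ-toℕ : ∀ r → toℕ r < α → toℕ (σ r) ≡ α ℕ.+ (g ℕ.+ toℕ r)
  σ-toℕ r r<α with toℕ r ℕP.<? α
  ... | yes _ = FP.toℕ-fromℕ< _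
  ... | no r≮α = ⊥-elim (r≮α r<α)
  σ∉A : ∀ r → toℕ r < α → ¬ (toℕ (σ r) < α)
  σ∉A r r<α σr<α = ℕP.<⇒≱ σr<α (subst (α ℕ.≤_) (sym (σ-toℕ r r<α)) (ℕP.m≤m+n α _))
  added : ∀ r c → toℕ r < α → M′ r c ≡ M r c + z * M (σ r) c
  added r c r<α with ℕP.m≤n⇒∃[o]m+o≡n r<α
  ... | h , e = trans (sylvesterRow-reduceA α β s g A B z (toℕ r) h β≡ (sym e) _)
                      (cong (λ i → M r c + z * sylvesterRow α β A B i _) (sym (σ-toℕ r r<α)))
  fixed : ∀ r c → ¬ (toℕ r < α) → M′ r c ≡ M r c
  fixed r c r≮α = trans (cong (λ P → P _) (sylvesterRow-B α β A′ B (toℕ r) (ℕP.≮⇒≥ r≮α)))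
                        (sym (cong (λ P → P _) (sylvesterRow-B α β A B (toℕ r) (ℕP.≮⇒≥ r≮α))))

-- Symmetrically, row α + t of B receives the row g + t of A.
sylvesterRow-reduceB : ∀ α β s g A B z t → α ≡ β ℕ.+ s ℕ.+ g → t < β → ∀ D →
  sylvesterRow α β A (λ e → B e + z * shift s A e) (α ℕ.+ t) D
    ≡ sylvesterRow α β A B (α ℕ.+ t) D + z * sylvesterRow α β A B (g ℕ.+ t) D
sylvesterRow-reduceB α β s g A B z t α≡ t<β D = begin
  sylvesterRow α β A (λ e → B e + z * shift s A e) (α ℕ.+ t) D
    ≡⟨ sylvesterRow-right α β A _ (α ℕ.+ t) t refl D ⟩
  shift (β ∸ suc t) (λ e → B e + z * shift s A e) D
    ≡⟨ shift-linear (β ∸ suc t) B (shift s A) z D ⟩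
  shift (β ∸ suc t) B D + z * shift (β ∸ suc t) (shift s A) D
    ≡⟨ cong₂ (λ a b → a + z * b) (sym (sylvesterRow-right α β A B (α ℕ.+ t) t refl D))
                                  (shift-shift (β ∸ suc t) s A D) ⟩
  sylvesterRow α β A B (α ℕ.+ t) D + z * shift ((β ∸ suc t) ℕ.+ s) A D
    ≡⟨ cong (λ b → sylvesterRow α β A B (α ℕ.+ t) D + z * b)
            (sym (sylvesterRow-left α β A B (g ℕ.+ t) ((β ∸ suc t) ℕ.+ s) partnerShift D)) ⟩
  sylvesterRow α β A B (α ℕ.+ t) D + z * sylvesterRow α β A B (g ℕ.+ t) D ∎
  where
  open ≡-Reasoning
  rearrange : ∀ m t s g → m ℕ.+ suc t ℕ.+ s ℕ.+ g ≡ suc (g ℕ.+ t) ℕ.+ (m ℕ.+ s)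
  rearrange = ℕSolver.solve-∀
  partnerShift : α ≡ suc (g ℕ.+ t) ℕ.+ ((β ∸ suc t) ℕ.+ s)
  partnerShift = trans α≡ (trans (cong (λ b → b ℕ.+ s ℕ.+ g) (sym (ℕP.m∸n+n≡m t<β)))
                                 (rearrange (β ∸ suc t) t s g))

Res-reduceB : ∀ α β s g A B z → α ≡ β ℕ.+ s ℕ.+ g →
  Res (α ℕ.+ β) α β A (λ i → B i + z * shift s A i) ≡ Res (α ℕ.+ β) α β A B
Res-reduceB α β s g A B z α≡ =
  det-addRowMultiples N M M′ (λ r → α ℕ.≤ toℕ r) (λ r → α ℕP.≤? toℕ r) σ z σ∉B added fixed
  where
  N = α ℕ.+ β
  B′ : Poly
  B′ i = B i + z * shift s A i
  M = Syl N α β A B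
  M′ = Syl N α β A B′
  partner<α : ∀ t → t < β → g ℕ.+ t < α
  partner<α t t<β = subst (g ℕ.+ t <_) (sym α≡)
    (ℕP.<-≤-trans (ℕP.+-monoʳ-< g t<β) (subst (g ℕ.+ β ℕ.≤_) (rearrange β s g) (ℕP.m≤m+n (g ℕ.+ β) s)))
    where
    rearrange : ∀ b s g → g ℕ.+ b ℕ.+ s ≡ b ℕ.+ s ℕ.+ g
    rearrange = ℕSolver.solve-∀
  offset : ∀ r → α ℕ.≤ toℕ r → ∃ λ t → toℕ r ≡ α ℕ.+ t
  offset r α≤r with ℕP.m≤n⇒∃[o]m+o≡n α≤r
  ... | t , e = t , sym e
  σ : Fin N → Fin N
  σ r with α ℕP.≤? toℕ r
  ... | yes α≤r = let (t , e) = offset r α≤r in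
                  F.fromℕ< (ℕP.<-≤-trans (partner<α t (index-of-B α (FP.toℕ<n r) e)) (ℕP.m≤m+n α β))
  ... | no _ = r
  σ-toℕ : ∀ r (α≤r : α ℕ.≤ toℕ r) → toℕ (σ r) ≡ g ℕ.+ proj₁ (offset r α≤r)
  σ-toℕ r α≤r with α ℕP.≤? toℕ r
  ... | yes α≤r′ = trans (FP.toℕ-fromℕ< _) (cong (λ p → g ℕ.+ proj₁ (offset r p)) (ℕP.≤-irrelevant α≤r′ α≤r))
  ... | no α≰r = ⊥-elim (α≰r α≤r)
  σ∉B : ∀ r → α ℕ.≤ toℕ r → ¬ (α ℕ.≤ toℕ (σ r))
  σ∉B r α≤r = ℕP.<⇒≱ (subst (_< α) (sym (σ-toℕ r α≤r))
                              (partner<α _ (index-of-B α (FP.toℕ<n r) (proj₂ (offset r α≤r)))))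
  added : ∀ r c → α ℕ.≤ toℕ r → M′ r c ≡ M r c + z * M (σ r) c
  added r c α≤r = begin
    sylvesterRow α β A B′ (toℕ r) D
      ≡⟨ cong (λ i → sylvesterRow α β A B′ i D) e ⟩
    sylvesterRow α β A B′ (α ℕ.+ t) D
      ≡⟨ sylvesterRow-reduceB α β s g A B z t α≡ (index-of-B α (FP.toℕ<n r) e) D ⟩
    sylvesterRow α β A B (α ℕ.+ t) D + z * sylvesterRow α β A B (g ℕ.+ t) D
      ≡⟨ cong₂ (λ i j → sylvesterRow α β A B i D + z * sylvesterRow α β A B j D) (sym e) (sym (σ-toℕ r α≤r)) ⟩
    M r c + z * M (σ r) c ∎
    where
    open ≡-Reasoning
    D = N ∸ suc (toℕ c)
    t = proj₁ (offset r α≤r)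
    e = proj₂ (offset r α≤r)
  fixed : ∀ r c → ¬ (α ℕ.≤ toℕ r) → M′ r c ≡ M r c
  fixed r c α≰r = trans (cong (λ P → P _) (sylvesterRow-A α β A B′ (toℕ r) (ℕP.≰⇒> α≰r)))
                        (sym (cong (λ P → P _) (sylvesterRow-A α β A B (toℕ r) (ℕP.≰⇒> α≰r))))

Res-stripLeadingA : ∀ α′ α β A B → α ℕ.≤ α′ → IsUnit (A β) → DegreeAtMost β A → DegreeAtMost α B →
  Res (α′ ℕ.+ β) α′ β A B ≈± Res (α ℕ.+ β) α β A B
Res-stripLeadingA α′ α β A B α≤α′ unit degA degB with ℕP.m≤n⇒∃[o]m+o≡n α≤α′
... | j , refl = subst (λ a → Res (a ℕ.+ β) a β A B ≈± Res (α ℕ.+ β) α β A B) (ℕP.+-comm j α) (strip j)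
  where
  strip : ∀ j → Res ((j ℕ.+ α) ℕ.+ β) (j ℕ.+ α) β A B ≈± Res (α ℕ.+ β) α β A B
  strip zero = ≈±-refl
  strip (suc j) = ≈±-trans (Res-leadingA (j ℕ.+ α) β A B unit degA (λ i j+α<i → degB i (ℕP.≤-<-trans (ℕP.m≤n+m α j) j+α<i)))
                           (strip j)

Res-stripLeadingB : ∀ α β′ β A B → β ℕ.≤ β′ → IsUnit (B α) → DegreeAtMost α B → DegreeAtMost β A →
  Res (α ℕ.+ β′) α β′ A B ≈± Res (α ℕ.+ β) α β A B
Res-stripLeadingB α β′ β A B β≤β′ unit degB degA with ℕP.m≤n⇒∃[o]m+o≡n β≤β′
... | j , refl = subst (λ b → Res (α ℕ.+ b) α b A B ≈± Res (α ℕ.+ β) α β A B) (ℕP.+-comm j β) (strip j)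
  where
  strip : ∀ j → Res (α ℕ.+ (j ℕ.+ β)) α (j ℕ.+ β) A B ≈± Res (α ℕ.+ β) α β A B
  strip zero = ≈±-refl
  strip (suc j) = ≈±-trans (inj₁ (cong (λ N → Res N α (suc j ℕ.+ β) A B) (ℕP.+-suc α (j ℕ.+ β))))
    (≈±-trans (Res-leadingB α (j ℕ.+ β) A B unit degB (λ i j+β<i → degA i (ℕP.≤-<-trans (ℕP.m≤n+m β j) j+β<i)))
              (strip j))

Res-stripConstantsA : ∀ j α β A B → IsUnit (A 0) → (∀ i → i < j → B i ≡ + 0) →
  Res ((j ℕ.+ α) ℕ.+ β) (j ℕ.+ α) β A B ≈± Res (α ℕ.+ β) α β A (λ i → B (j ℕ.+ i))
Res-stripConstantsA zero α β A B unit low = ≈±-refl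
Res-stripConstantsA (suc j) α β A B unit low =
  ≈±-trans (Res-constantA (j ℕ.+ α) β A B unit (low 0 (s≤s z≤n)))
           (Res-stripConstantsA j α β A (dropConstant B) unit (λ i i<j → low (suc i) (s≤s i<j)))

Res-noRowsA : ∀ N β A A′ B → Res N 0 β A B ≡ Res N 0 β A′ B
Res-noRowsA N β A A′ B = det-cong N (λ r c →
  trans (cong (λ P → P _) (sylvesterRow-B 0 β A B (toℕ r) z≤n))
        (sym (cong (λ P → P _) (sylvesterRow-B 0 β A′ B (toℕ r) z≤n))))

-- Resultants against ε (x^d - 1)

module Binomial (d₀ : ℕ) (ε : ℤ) (unit : IsUnit ε) where
  d : ℕ
  d = suc d₀

  binomial : Poly
  binomial i = ε * (δ d i - δ 0 i)

  binomial-leading : IsUnit (binomial d)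
  binomial-leading = subst IsUnit (sym (trans (cong (λ x → ε * (x - δ 0 d)) (δ-refl d)) (ℤP.*-identityʳ ε))) unit

  binomial-degree : DegreeAtMost d binomial
  binomial-degree i d<i =
    trans (cong₂ (λ x y → ε * (x - y)) (δ-degree d i d<i) (δ-degree 0 i (ℕP.<-trans (s≤s z≤n) d<i)))
          (ℤP.*-zeroʳ ε)

  shift-binomial : ∀ t i → shift t binomial i ≡ ε * (δ (t ℕ.+ d) i - δ t i)
  shift-binomial zero i = refl
  shift-binomial (suc t) zero = sym (ℤP.*-zeroʳ ε)
  shift-binomial (suc t) (suc i) = shift-binomial t i

  ε²-cancel : ∀ x y → x + (- ε) * (ε * (x - y)) ≡ y
  ε²-cancel = cancel unit
    where
    cancel : ∀ {e} → IsUnit e → ∀ x y → x + (- e) * (e * (x - y)) ≡ y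
    cancel (inj₁ refl) = solve-∀
    cancel (inj₂ refl) = solve-∀

  -- x^(d+t) ≡ x^t modulo ε (x^d - 1), then strip the d leading rows of the binomial.
  Res-monomial-reduce : ∀ t → Res (d ℕ.+ (d ℕ.+ t)) d (d ℕ.+ t) (δ (d ℕ.+ t)) binomial ≈± Res (d ℕ.+ t) d t (δ t) binomial
  Res-monomial-reduce t = begin
    Res (d ℕ.+ (d ℕ.+ t)) d (d ℕ.+ t) (δ (d ℕ.+ t)) binomial
      ≡⟨ sym (Res-reduceA d (d ℕ.+ t) t 0 (δ (d ℕ.+ t)) binomial (- ε) (sym (ℕP.+-identityʳ _))) ⟩
    Res (d ℕ.+ (d ℕ.+ t)) d (d ℕ.+ t) (λ i → δ (d ℕ.+ t) i + (- ε) * shift t binomial i) binomial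
      ≡⟨ Res-cong (d ℕ.+ (d ℕ.+ t)) d (d ℕ.+ t) reduced (λ _ → refl) ⟩
    Res (d ℕ.+ (d ℕ.+ t)) d (d ℕ.+ t) (δ t) binomial
      ∼⟨ Res-stripLeadingB d (d ℕ.+ t) t (δ t) binomial (ℕP.m≤n+m t d) binomial-leading binomial-degree (δ-degree t) ⟩
    Res (d ℕ.+ t) d t (δ t) binomial ∎
    where
    open ≈±-Reasoning
    reduced : ∀ i → δ (d ℕ.+ t) i + (- ε) * shift t binomial i ≡ δ t i
    reduced i = trans (cong (λ x → δ (d ℕ.+ t) i + (- ε) * x)
                        (trans (shift-binomial t i) (cong (λ a → ε * (δ a i - δ t i)) (ℕP.+-comm t d))))
                      (ε²-cancel (δ (d ℕ.+ t) i) (δ t i))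

  -- For m < d, adding -ε x^(d-m) times x^m turns the binomial into the unit constant -ε.
  Res-monomial-small : ∀ m k → d ≡ suc m ℕ.+ k → Res (d ℕ.+ m) d m (δ m) binomial ≈± + 1
  Res-monomial-small m k d≡ = begin
    Res (d ℕ.+ m) d m (δ m) binomial
      ≡⟨ sym (Res-reduceB d m (suc k) 0 (δ m) binomial (- ε) (trans d≡ (rearrange m k))) ⟩
    Res (d ℕ.+ m) d m (δ m) (λ i → binomial i + (- ε) * shift (suc k) (δ m) i)
      ≡⟨ Res-cong (d ℕ.+ m) d m (λ _ → refl) constant ⟩
    Res (d ℕ.+ m) d m (δ m) c
      ∼⟨ Res-stripLeadingA d 0 m (δ m) c z≤n (inj₁ (δ-refl m)) (δ-degree m) c-degree ⟩
    Res m 0 m (δ m) c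
      ≡⟨ Res-noRowsA m m (δ m) (λ _ → + 0) c ⟩
    Res m 0 m (λ _ → + 0) c
      ∼⟨ Res-stripLeadingB 0 m 0 (λ _ → + 0) c z≤n (isUnit-* (isUnit-neg unit) (inj₁ refl)) c-degree (λ _ _ → refl) ⟩
    + 1 ∎
    where
    open ≈±-Reasoning
    c : Poly
    c i = (- ε) * δ 0 i
    c-degree : DegreeAtMost 0 c
    c-degree i 0<i = trans (cong ((- ε) *_) (δ-degree 0 i 0<i)) (ℤP.*-zeroʳ (- ε))
    rearrange : ∀ m k → suc m ℕ.+ k ≡ m ℕ.+ suc k ℕ.+ 0
    rearrange = ℕSolver.solve-∀
    constant : ∀ i → binomial i + (- ε) * shift (suc k) (δ m) i ≡ c i
    constant i = trans (cong (λ x → binomial i + (- ε) * x)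
                         (trans (shift-δ (suc k) m i) (cong (λ a → δ a i) (trans (cong suc (ℕP.+-comm k m)) (sym d≡)))))
                       (expand ε (δ d i) (δ 0 i))
      where
      expand : ∀ ε x y → ε * (x - y) + (- ε) * x ≡ (- ε) * y
      expand = solve-∀

  Res-monomial : ∀ m → Res (d ℕ.+ m) d m (δ m) binomial ≈± + 1
  Res-monomial = <-rec (λ m → Res (d ℕ.+ m) d m (δ m) binomial ≈± + 1) step
    where
    step : ∀ m → (∀ {t} → t < m → Res (d ℕ.+ t) d t (δ t) binomial ≈± + 1) →
      Res (d ℕ.+ m) d m (δ m) binomial ≈± + 1
    step m smaller with cut d m
    ... | left k d≡ = Res-monomial-small m k d≡
    ... | right t refl = ≈±-trans (Res-monomial-reduce t) (smaller (ℕP.m<n+m t (s≤s z≤n)))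

  -- The A-polynomial x^n - x^k + x^(t d): adding ε x^(t d) times the binomial raises t by one.
  partialReduction : ℕ → ℕ → ℕ → Poly
  partialReduction n k t i = δ n i - δ k i + δ (t ℕ.* d) i

  Res-partialReduction : ∀ n k q t → t ℕ.≤ q → q ℕ.* d ℕ.≤ n →
    Res (d ℕ.+ n) d n (partialReduction n k t) binomial ≡ Res (d ℕ.+ n) d n (trinomial n k) binomial
  Res-partialReduction n k q zero _ _ = refl
  Res-partialReduction n k q (suc t) t<q qd≤n with ℕP.m≤n⇒∃[o]m+o≡n (ℕP.≤-trans (ℕP.*-monoˡ-≤ d t<q) qd≤n)
  ... | g , e = begin
    Res (d ℕ.+ n) d n (partialReduction n k (suc t)) binomial
      ≡⟨ Res-cong (d ℕ.+ n) d n raised (λ _ → refl) ⟩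
    Res (d ℕ.+ n) d n (λ i → partialReduction n k t i + ε * shift (t ℕ.* d) binomial i) binomial
      ≡⟨ Res-reduceA d n (t ℕ.* d) g (partialReduction n k t) binomial ε (sym e) ⟩
    Res (d ℕ.+ n) d n (partialReduction n k t) binomial
      ≡⟨ Res-partialReduction n k q t (ℕP.<⇒≤ t<q) qd≤n ⟩
    Res (d ℕ.+ n) d n (trinomial n k) binomial ∎
    where
    open ≡-Reasoning
    square : ∀ {e} → IsUnit e → ∀ x y z a → x - y + a ≡ x - y + z + e * (e * (a - z))
    square (inj₁ refl) = solve-∀
    square (inj₂ refl) = solve-∀
    raised : ∀ i → partialReduction n k (suc t) i ≡ partialReduction n k t i + ε * shift (t ℕ.* d) binomial i
    raised i = begin
      partialReduction n k (suc t) i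
        ≡⟨ square unit (δ n i) (δ k i) (δ (t ℕ.* d) i) (δ (suc t ℕ.* d) i) ⟩
      partialReduction n k t i + ε * (ε * (δ (d ℕ.+ t ℕ.* d) i - δ (t ℕ.* d) i))
        ≡⟨ cong (λ a → partialReduction n k t i + ε * (ε * (δ a i - δ (t ℕ.* d) i))) (ℕP.+-comm d (t ℕ.* d)) ⟩
      partialReduction n k t i + ε * (ε * (δ (t ℕ.* d ℕ.+ d) i - δ (t ℕ.* d) i))
        ≡⟨ cong (λ b → partialReduction n k t i + ε * b) (sym (shift-binomial (t ℕ.* d) i)) ⟩
      partialReduction n k t i + ε * shift (t ℕ.* d) binomial i ∎

  Res-trinomial : ∀ n k q → k ≡ q ℕ.* d → k ℕ.≤ n → Res (d ℕ.+ n) d n (trinomial n k) binomial ≈± + 1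
  Res-trinomial n k q k≡ k≤n = begin
    Res (d ℕ.+ n) d n (trinomial n k) binomial
      ≡⟨ sym (Res-partialReduction n k q q ℕP.≤-refl (subst (ℕ._≤ n) k≡ k≤n)) ⟩
    Res (d ℕ.+ n) d n (partialReduction n k q) binomial
      ≡⟨ Res-cong (d ℕ.+ n) d n reduced (λ _ → refl) ⟩
    Res (d ℕ.+ n) d n (δ n) binomial
      ∼⟨ Res-monomial n ⟩
    + 1 ∎
    where
    open ≈±-Reasoning
    cancel : ∀ x y → x - y + y ≡ x
    cancel = solve-∀
    reduced : ∀ i → partialReduction n k q i ≡ δ n i
    reduced i = trans (cong (λ a → δ n i - δ k i + δ a i) (sym k≡)) (cancel (δ n i) (δ k i))

sylEntry≡shift : ∀ n P ρ c → ρ < n → c < n ℕ.+ n → DegreeAtMost n P →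
  sylEntry n P ρ c ≡ shift (n ∸ suc ρ) P (n ℕ.+ n ∸ suc c)
sylEntry≡shift n P ρ c ρ<n c<2n degP with ℕP.m≤n⇒∃[o]m+o≡n ρ<n | ℕP.m≤n⇒∃[o]m+o≡n c<2n
... | s , refl | D , eD = trans (byColumn (cut ρ c)) (sym (cong₂ (λ a b → shift a P b)
  (ℕP.m+n∸m≡n (suc ρ) s) (trans (cong (_∸ suc c) (sym eD)) (ℕP.m+n∸m≡n (suc c) D))))
  where
  n′ = suc ρ ℕ.+ s
  byColumn : Cut ρ c → sylEntry n′ P ρ c ≡ shift s P D
  byColumn (left a refl) rewrite <ᵇ-true (s≤s (ℕP.m≤m+n c a)) =
    sym (trans (shift-≡ s P (n′ ℕ.+ suc a) D (ℕP.+-cancelˡ-≡ (suc c) D _ (trans eD (rearrange c a s))))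
               (degP _ (ℕP.m<m+n n′ (s≤s z≤n))))
    where
    rearrange : ∀ c a s → let n = suc (suc c ℕ.+ a) ℕ.+ s in n ℕ.+ n ≡ suc c ℕ.+ (s ℕ.+ (n ℕ.+ suc a))
    rearrange = ℕSolver.solve-∀
  byColumn (right u refl) rewrite <ᵇ-false (ℕP.m≤m+n ρ u) | ℕP.m+n∸m≡n ρ u = byDegree (cut (suc n′) u)
    where
    byDegree : Cut (suc n′) u → (if n′ ℕ.<ᵇ u then + 0 else P (n′ ∸ u)) ≡ shift s P D
    byDegree (left v e) rewrite ℕP.suc-injective e | <ᵇ-false (ℕP.m≤m+n u v) | ℕP.m+n∸m≡n u v =
      sym (shift-≡ s P v D (ℕP.+-cancelˡ-≡ (suc (ρ ℕ.+ u)) D (s ℕ.+ v)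
        (trans eD (trans (cong (n′ ℕ.+_) (ℕP.suc-injective e)) (rearrange ρ s u v)))))
      where
      rearrange : ∀ ρ s u v → suc ρ ℕ.+ s ℕ.+ (u ℕ.+ v) ≡ suc (ρ ℕ.+ u) ℕ.+ (s ℕ.+ v)
      rearrange = ℕSolver.solve-∀
    byDegree (right b refl) rewrite <ᵇ-true (s≤s (ℕP.m≤m+n n′ b)) =
      sym (shift-< s P D (subst (D <_) (ℕP.+-cancelˡ-≡ (n′ ℕ.+ suc ρ) (suc (b ℕ.+ D)) s
        (trans (sym (rearrange ρ s b D)) (trans eD (sym (ℕP.+-assoc n′ (suc ρ) s))))) (s≤s (ℕP.m≤n+m D b))))
      where
      rearrange : ∀ ρ s b D → let n = suc ρ ℕ.+ s in
        suc (ρ ℕ.+ suc (n ℕ.+ b)) ℕ.+ D ≡ (n ℕ.+ suc ρ) ℕ.+ suc (b ℕ.+ D)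
      rearrange = ℕSolver.solve-∀

resultant≡Res : ∀ n F G → DegreeAtMost n F → DegreeAtMost n G → resultant n n F G ≡ Res (n ℕ.+ n) n n F G
resultant≡Res n F G degF degG = det-cong (n ℕ.+ n) entry
  where
  entry : ∀ r c → sylvester n n F G r c ≡ Syl (n ℕ.+ n) n n F G r c
  entry r c with toℕ r ℕP.<? n
  ... | yes r<n rewrite <ᵇ-true r<n = sylEntry≡shift n F (toℕ r) (toℕ c) r<n (FP.toℕ<n c) degF
  ... | no r≮n rewrite <ᵇ-false (ℕP.≮⇒≥ r≮n) =
    sylEntry≡shift n G (toℕ r ∸ n) (toℕ c) (offset (ℕP.m≤n⇒∃[o]m+o≡n (ℕP.≮⇒≥ r≮n))) (FP.toℕ<n c) degG
    where
    offset : ∃ (λ t → n ℕ.+ t ≡ toℕ r) → toℕ r ∸ n < n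
    offset (t , e) = subst (_< n) (sym (trans (cong (_∸ n) (sym e)) (ℕP.m+n∸m≡n n t)))
                           (index-of-B n (FP.toℕ<n r) (sym e))

-- The two trinomials

trinomial-degree : ∀ {n k} → k < n → DegreeAtMost n (trinomial n k)
trinomial-degree {n} {k} k<n i n<i
  rewrite δ-degree n i n<i | δ-degree k i (ℕP.<-trans k<n n<i) | δ-degree 0 i (ℕP.≤-<-trans z≤n n<i) = refl

trinomial-leading : ∀ {n k} → k < n → IsUnit (trinomial n k n)
trinomial-leading {n} {k} k<n
  rewrite δ-refl n | δ-degree k n k<n | δ-degree 0 n (ℕP.≤-<-trans z≤n k<n) = inj₁ refl

trinomial-constant : ∀ {n k} → 0 < k → k < n → IsUnit (trinomial n k 0)
trinomial-constant {n} {k} 0<k k<n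
  rewrite δ-≢ n 0 (ℕP.<⇒≢ (ℕP.≤-<-trans z≤n k<n)) | δ-≢ k 0 (ℕP.<⇒≢ 0<k) = inj₁ refl

Res-trinomial-subtract : ∀ n k j →
  Res (n ℕ.+ n) n n (trinomial n k) (trinomial n j) ≡ Res (n ℕ.+ n) n n (trinomial n k) (λ i → δ k i - δ j i)
Res-trinomial-subtract n k j = begin
  Res (n ℕ.+ n) n n (trinomial n k) (trinomial n j)
    ≡⟨ sym (Res-reduceB n n 0 0 (trinomial n k) (trinomial n j) (- + 1) (sym (trans (ℕP.+-identityʳ _) (ℕP.+-identityʳ n)))) ⟩
  Res (n ℕ.+ n) n n (trinomial n k) (λ i → trinomial n j i + (- + 1) * trinomial n k i)
    ≡⟨ Res-cong (n ℕ.+ n) n n (λ _ → refl) (λ i → cancel (δ n i) (δ j i) (δ 0 i) (δ k i)) ⟩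
  Res (n ℕ.+ n) n n (trinomial n k) (λ i → δ k i - δ j i) ∎
  where
  open ≡-Reasoning
  cancel : ∀ a b c e → (a - b + c) + (- + 1) * (a - e + c) ≡ e - b
  cancel = solve-∀

record BinomialFactor (k j : ℕ) : Set where
  field
    s d₀ : ℕ
    ε : ℤ
    unit : IsUnit ε
    factor : ∀ i → δ k i - δ j i ≡ shift s (Binomial.binomial d₀ ε unit) i
    top : s ℕ.+ suc d₀ ≡ k ℕ.⊔ j
    gap : ℤ.∣ + k - + j ∣ ≡ suc d₀

∣[m+d]-m∣≡d : ∀ m d → ℤ.∣ + (m ℕ.+ d) - + m ∣ ≡ d
∣[m+d]-m∣≡d m d = trans (cong ℤ.∣_∣ (trans (ℤP.m-n≡m⊖n (m ℕ.+ d) m) (ℤP.⊖-≥ (ℕP.m≤m+n m d))))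
                        (ℕP.m+n∸m≡n m d)

binomialFactor-< : ∀ k d₀ → BinomialFactor k (suc k ℕ.+ d₀)
binomialFactor-< k d₀ = record
  { s = k ; d₀ = d₀ ; ε = - + 1 ; unit = inj₂ refl
  ; factor = λ i → trans (negate (δ k i) (δ (suc k ℕ.+ d₀) i))
      (sym (trans (Binomial.shift-binomial d₀ (- + 1) (inj₂ refl) k i)
                  (cong (λ a → (- + 1) * (δ a i - δ k i)) (ℕP.+-suc k d₀))))
  ; top = trans (ℕP.+-suc k d₀) (sym (ℕP.m≤n⇒m⊔n≡n (ℕP.m≤n⇒m≤1+n (ℕP.m≤m+n k d₀))))
  ; gap = trans (ℤP.∣i-j∣≡∣j-i∣ (+ k) (+ (suc k ℕ.+ d₀)))
                (trans (cong (λ a → ℤ.∣ + a - + k ∣) (sym (ℕP.+-suc k d₀))) (∣[m+d]-m∣≡d k (suc d₀)))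
  }
  where
  negate : ∀ x y → x - y ≡ (- + 1) * (y - x)
  negate = solve-∀

binomialFactor-> : ∀ j d₀ → BinomialFactor (suc j ℕ.+ d₀) j
binomialFactor-> j d₀ = record
  { s = j ; d₀ = d₀ ; ε = + 1 ; unit = inj₁ refl
  ; factor = λ i → sym (trans (Binomial.shift-binomial d₀ (+ 1) (inj₁ refl) j i)
      (trans (ℤP.*-identityˡ _) (cong (λ a → δ a i - δ j i) (ℕP.+-suc j d₀))))
  ; top = trans (ℕP.+-suc j d₀) (sym (ℕP.m≥n⇒m⊔n≡m (ℕP.m≤n⇒m≤1+n (ℕP.m≤m+n j d₀))))
  ; gap = trans (cong (λ a → ℤ.∣ + a - + j ∣) (sym (ℕP.+-suc j d₀))) (∣[m+d]-m∣≡d j (suc d₀))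
  }

binomialFactor : ∀ k j → k ≢ j → BinomialFactor k j
binomialFactor k j k≢j with ℕP.<-cmp k j
... | tri< k<j _ _ = subst (BinomialFactor k) (proj₂ (ℕP.m≤n⇒∃[o]m+o≡n k<j)) (binomialFactor-< k _)
... | tri≈ _ k≡j _ = ⊥-elim (k≢j k≡j)
... | tri> _ _ j<k = subst (λ a → BinomialFactor a j) (proj₂ (ℕP.m≤n⇒∃[o]m+o≡n j<k)) (binomialFactor-> j _)

Res-trinomial-shiftedBinomial : ∀ n k s d₀ ε (unit : IsUnit ε) q → 0 < k → k < n →
  s ℕ.+ suc d₀ ℕ.≤ n → k ≡ q ℕ.* suc d₀ →
  Res (n ℕ.+ n) n n (trinomial n k) (shift s (Binomial.binomial d₀ ε unit)) ≈± + 1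
Res-trinomial-shiftedBinomial n k s d₀ ε unit q 0<k k<n s+d≤n k≡ = begin
  Res (n ℕ.+ n) n n F (shift s binomial)
    ∼⟨ Res-stripLeadingA n (s ℕ.+ d) n F (shift s binomial) s+d≤n (trinomial-leading k<n) (trinomial-degree k<n)
         (shift-degree s d binomial binomial-degree) ⟩
  Res ((s ℕ.+ d) ℕ.+ n) (s ℕ.+ d) n F (shift s binomial)
    ∼⟨ Res-stripConstantsA s d n F (shift s binomial) (trinomial-constant 0<k k<n) (λ i → shift-< s binomial i) ⟩
  Res (d ℕ.+ n) d n F (λ i → shift s binomial (s ℕ.+ i))
    ≡⟨ Res-cong (d ℕ.+ n) d n (λ _ → refl) (shift-+ s binomial) ⟩
  Res (d ℕ.+ n) d n F binomial
    ∼⟨ Res-trinomial n k q k≡ (ℕP.<⇒≤ k<n) ⟩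
  + 1 ∎
  where
  open ≈±-Reasoning
  open Binomial d₀ ε unit
  F = trinomial n k

isUnit⇒dyadic : ∀ {x} → IsUnit x → ∃ λ m → (x ≡ + (2 ℕ.^ m)) ⊎ (x ≡ - (+ (2 ℕ.^ m)))
isUnit⇒dyadic unit = 0 , unit

mainTheorem4 : (n k j : ℕ) → 0 < k → k < n → 0 < j → j < n → k ≢ j →
    ((+ k) - (+ j)) ∣ (+ k) →
    DyadicallyResolve n n (trinomial n k) (trinomial n j)
mainTheorem4 n k j 0<k k<n _ j<n k≢j (divides q k≡q∣k-j∣) = isUnit⇒dyadic (begin
  resultant n n (trinomial n k) (trinomial n j)
    ≡⟨ resultant≡Res n _ _ (trinomial-degree k<n) (trinomial-degree j<n) ⟩
  Res (n ℕ.+ n) n n (trinomial n k) (trinomial n j)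
    ≡⟨ Res-trinomial-subtract n k j ⟩
  Res (n ℕ.+ n) n n (trinomial n k) (λ i → δ k i - δ j i)
    ≡⟨ Res-cong (n ℕ.+ n) n n (λ _ → refl) factor ⟩
  Res (n ℕ.+ n) n n (trinomial n k) (shift s (Binomial.binomial d₀ ε unit))
    ∼⟨ Res-trinomial-shiftedBinomial n k s d₀ ε unit q 0<k k<n s+d≤n (trans k≡q∣k-j∣ (cong (q ℕ.*_) gap)) ⟩
  + 1 ∎)
  where
  open ≈±-Reasoning
  open BinomialFactor (binomialFactor k j k≢j)
  s+d≤n : s ℕ.+ suc d₀ ℕ.≤ n
  s+d≤n = subst (ℕ._≤ n) (sym top) (ℕP.⊔-lub (ℕP.<⇒≤ k<n) (ℕP.<⇒≤ j<n))
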